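{- Let $A$ be a nonnegative $m\times n$ real matrix with positive row sums and positive column sums, and let $\mathbf r=(r_1,\ldots,r_m)^t\in\mathbf R^m$ and $\mathbf c=(c_1,\ldots,c_n)^t\in\mathbf R^n$ be positive vectors. Define the sequence $A_0=A$, $A_1=\mathcal C(A_0)$, $A_2=\mathcal R(A_1)$, $A_3=\mathcal C(A_2)$, $A_4=\mathcal R(A_3),\ldots$ obtained by alternately applying column scaling and row scaling (starting with a column scaling). If there is a least integer $L\ge 0$ such that $A_L$ is $(\mathbf r,\mathbf c)$-doubly stochastic (i.e. alternate column and row scaling transforms $A$ into an $(\mathbf r,\mathbf c)$-doubly stochastic matrix in exactly $L$ steps), then $L\le 2$.
   Context: For an $m\times n$ matrix $A=(a_{i,j})$, $\mathrm{rowsum}_i(A)=\sum_{j=1}^n a_{i,j}$ and $\mathrm{colsum}_j(A)=\sum_{i=1}^m a_{i,j}$. A nonnegative matrix $A$ is $\mathbf r$-row stochastic if $\mathrm{rowsum}_i(A)=r_i$ for all $i$, $\mathbf c$-column stochastic if $\mathrm{colsum}_j(A)=c_j$ for all $j$, and $(\mathbf r,\mathbf c)$-doubly stochastic if both. Column scaling: for nonnegative $A$ with positive column sums, $\mathcal C(A)=A\,\mathrm{diag}\big(c_1/\mathrm{colsum}_1(A),\ldots,c_n/\mathrm{colsum}_n(A)\big)$, which is $\mathbf c$-column stochastic. Row scaling: for nonnegative $A$ with positive row sums, $\mathcal R(A)=\mathrm{diag}\big(r_1/\mathrm{rowsum}_1(A),\ldots,r_m/\mathrm{rowsum}_m(A)\big)\,A$,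 which is $\mathbf r$-row stochastic. Each scaling preserves positivity of both row and column sums, so the sequence is well defined. Each application of $\mathcal C$ or $\mathcal R$ counts as one step. -}

module Defs where

open import Level using (Level; _⊔_; suc)
open import Data.Nat using (ℕ; zero) renaming (suc to sucℕ)
open import Data.Fin using (Fin) renaming (zero to fz; suc to fs)
open import Data.Sum using (_⊎_)
open import Data.Product using (_×_)
open import Relation.Nullary using (¬_)
open import Relation.Binary.Core using (Rel)
open import Relation.Binary.Structures using (IsStrictTotalOrder)
open import Algebra.Bundles using (CommutativeRing)

-- An ordered field (the real numbers are one; the statement is made for
-- every ordered field, which in particular covers ℝ).  The inverse is a
-- total operation whose value at 0 is unconstrained.
record OrderedField (c ℓ : Level) : Set (suc (c ⊔ ℓ)) where
  field
    commutativeRing : CommutativeRing c ℓ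
  open CommutativeRing commutativeRing public
  infix 4 _<_
  infix 8 _⁻¹
  field
    _<_ : Rel Carrier ℓ
    <-isStrictTotalOrder : IsStrictTotalOrder _≈_ _<_
    _⁻¹ : Carrier → Carrier
    ⁻¹-cong : ∀ {x y} → x ≈ y → x ⁻¹ ≈ y ⁻¹
    0≉1 : ¬ (0# ≈ 1#)
    ⁻¹-inverse : ∀ x → ¬ (x ≈ 0#) → x * x ⁻¹ ≈ 1#
    +-mono-< : ∀ {x y} z → x < y → x + z < y + z
    *-pos : ∀ {x y} → 0# < x → 0# < y → 0# < x * y

  infix 4 _≤_
  _≤_ : Rel Carrier ℓ
  x ≤ y = x < y ⊎ x ≈ y

module Matrices {c ℓ} (F : OrderedField c ℓ) where
  open OrderedField F

  Matrix : ℕ → ℕ → Set c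
  Matrix m n = Fin m → Fin n → Carrier

  Vector : ℕ → Set c
  Vector n = Fin n → Carrier

  Σ : ∀ {n} → (Fin n → Carrier) → Carrier
  Σ {zero}   f = 0#
  Σ {sucℕ n} f = f fz + Σ (λ i → f (fs i))

  rowsum : ∀ {m n} → Matrix m n → Fin m → Carrier
  rowsum A i = Σ (λ j → A i j)

  colsum : ∀ {m n} → Matrix m n → Fin n → Carrier
  colsum A j = Σ (λ i → A i j)

  Nonneg : ∀ {m n} → Matrix m n → Set ℓ
  Nonneg A = ∀ i j → 0# ≤ A i j

  PositiveVec : ∀ {n} → Vector n → Set ℓ
  PositiveVec v = ∀ i → 0# < v i

  RowStochastic : ∀ {m n} → Vector m → Matrix m n → Set ℓ
  RowStochastic r A = ∀ i → rowsum A i ≈ r i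

  ColStochastic : ∀ {m n} → Vector n → Matrix m n → Set ℓ
  ColStochastic c A = ∀ j → colsum A j ≈ c j

  DoublyStochastic : ∀ {m n} → Vector m → Vector n → Matrix m n → Set ℓ
  DoublyStochastic r c A = RowStochastic r A × ColStochastic c A

  colScale : ∀ {m n} → Vector n → Matrix m n → Matrix m n
  colScale c A i j = A i j * (c j * (colsum A j) ⁻¹)

  rowScale : ∀ {m n} → Vector m → Matrix m n → Matrix m n
  rowScale r A i j = (r i * (rowsum A i) ⁻¹) * A i j

  step : ∀ {m n} → Vector m → Vector n → ℕ → Matrix m n → Matrix m n
  step r c zero            A = colScale c A
  step r c (sucℕ zero)     A = rowScale r A
  step r c (sucℕ (sucℕ k)) A = step r c k A

  -- A_0 = A, A_{k+1} = step k A_k, i.e. A_1 = 𝒞(A_0), A_2 = ℛ(A_1), A_3 = 𝒞(A_2), …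
  altScale : ∀ {m n} → Vector m → Vector n → Matrix m n → ℕ → Matrix m n
  altScale r c A zero     = A
  altScale r c A (sucℕ k) = step r c k (altScale r c A k)

-- Suppose scaling B to P (rows) and then P to Q (columns) leaves the row sums unchanged,
-- where B already has column sums c.  Write d for the column sums of P, so Q = P diag(y)
-- with d_j y_j = c_j, and put e_j = y_j - 1.  Equal row sums of P and Q say that every row
-- of P, hence every row of B, annihilates e; summing over the rows gives
-- Σ_j d_j e_j = 0 = Σ_j c_j e_j.  Then Σ_j d_j e_j² = Σ_j c_j e_j - Σ_j d_j e_j = 0 with
-- d_j > 0, so e = 0 and P already has column sums c.  Applied to transposes, the same
-- argument handles a column scaling followed by a row scaling.  Hence if A_{k+3} is doubly
-- stochastic then so is A_{k+2}, and the first doubly stochastic iterate has index ≤ 2.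
module Submission where

open import Defs
open import Level using (Level)
open import Data.Nat using (ℕ; z≤n; s≤s) renaming (zero to zeroℕ; suc to sucℕ)
open import Data.Nat.Properties using (n<1+n)
open import Data.Fin using (Fin) renaming (zero to fz; suc to fs)
open import Data.Product using (_×_; _,_; proj₁; proj₂)
open import Data.Sum using (inj₁; inj₂)
open import Data.Empty using (⊥-elim)
open import Relation.Nullary using (¬_)
open import Relation.Binary.Structures using (IsStrictTotalOrder)
open import Relation.Binary.Definitions using (tri<; tri≈; tri>)
import Algebra.Properties.Ring as RingProperties
import Algebra.Properties.Group as GroupProperties
import Relation.Binary.Reasoning.Setoid as SetoidReasoning

module OrderedFieldProperties {a ℓ} (F : OrderedField a ℓ) where
  open OrderedField F
  open IsStrictTotalOrder <-isStrictTotalOrder public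
    using (compare; irrefl; <-respʳ-≈; <-respˡ-≈) renaming (trans to <-trans)
  open RingProperties ring using (-‿distribˡ-*; -‿distribʳ-*)
  open GroupProperties +-group using (⁻¹-involutive)
  open SetoidReasoning setoid

  pos⇒≉0 : ∀ {x} → 0# < x → ¬ x ≈ 0#
  pos⇒≉0 0<x x≈0 = irrefl (sym x≈0) 0<x

  neg⇒-pos : ∀ {x} → x < 0# → 0# < - x
  neg⇒-pos {x} x<0 = <-respˡ-≈ (-‿inverseʳ x) (<-respʳ-≈ (+-identityˡ (- x)) (+-mono-< (- x) x<0))

  -x*-x≈x*x : ∀ x → - x * - x ≈ x * x
  -x*-x≈x*x x = begin
    - x * - x     ≈⟨ -‿distribʳ-* (- x) x ⟨
    - (- x * x)   ≈⟨ -‿cong (-‿distribˡ-* x x) ⟨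
    - - (x * x)   ≈⟨ ⁻¹-involutive (x * x) ⟩
    x * x         ∎

  x≉0⇒0<x*x : ∀ {x} → ¬ x ≈ 0# → 0# < x * x
  x≉0⇒0<x*x {x} x≉0 with compare x 0#
  ... | tri< x<0 _ _ = <-respʳ-≈ (-x*-x≈x*x x) (*-pos (neg⇒-pos x<0) (neg⇒-pos x<0))
  ... | tri≈ _ x≈0 _ = ⊥-elim (x≉0 x≈0)
  ... | tri> _ _ 0<x = *-pos 0<x 0<x

  x*x≈0⇒x≈0 : ∀ {x} → x * x ≈ 0# → x ≈ 0#
  x*x≈0⇒x≈0 {x} x*x≈0 with compare x 0#
  ... | tri≈ _ x≈0 _ = x≈0
  ... | tri< _ x≉0 _ = ⊥-elim (irrefl (sym x*x≈0) (x≉0⇒0<x*x x≉0))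
  ... | tri> _ x≉0 _ = ⊥-elim (irrefl (sym x*x≈0) (x≉0⇒0<x*x x≉0))

  0≤x*x : ∀ x → 0# ≤ x * x
  0≤x*x x with compare x 0#
  ... | tri≈ _ x≈0 _ = inj₂ (sym (trans (*-congʳ x≈0) (zeroˡ x)))
  ... | tri< _ x≉0 _ = inj₁ (x≉0⇒0<x*x x≉0)
  ... | tri> _ x≉0 _ = inj₁ (x≉0⇒0<x*x x≉0)

  x*[y*x⁻¹]≈y : ∀ {x} y → ¬ x ≈ 0# → x * (y * x ⁻¹) ≈ y
  x*[y*x⁻¹]≈y {x} y x≉0 = begin
    x * (y * x ⁻¹)   ≈⟨ *-congˡ (*-comm y (x ⁻¹)) ⟩
    x * (x ⁻¹ * y)   ≈⟨ *-assoc x (x ⁻¹) y ⟨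
    (x * x ⁻¹) * y   ≈⟨ *-congʳ (⁻¹-inverse x x≉0) ⟩
    1# * y           ≈⟨ *-identityˡ y ⟩
    y                ∎

  x≉0⇒x*y≈0⇒y≈0 : ∀ {x y} → ¬ x ≈ 0# → x * y ≈ 0# → y ≈ 0#
  x≉0⇒x*y≈0⇒y≈0 {x} {y} x≉0 x*y≈0 = begin
    y                    ≈⟨ x*[y*x⁻¹]≈y y x≉0 ⟨
    x * (y * x ⁻¹)       ≈⟨ *-assoc x y (x ⁻¹) ⟨
    (x * y) * x ⁻¹       ≈⟨ *-congʳ x*y≈0 ⟩
    0# * x ⁻¹            ≈⟨ zeroˡ (x ⁻¹) ⟩
    0#                   ∎

  -- x⁻¹ = x · (x⁻¹)², a product of two positives.
  0<x⇒0<x⁻¹ : ∀ {x} → 0# < x → 0# < x ⁻¹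
  0<x⇒0<x⁻¹ {x} 0<x = <-respʳ-≈ x*[x⁻¹*x⁻¹]≈x⁻¹ (*-pos 0<x (x≉0⇒0<x*x x⁻¹≉0))
    where
      x⁻¹≉0 : ¬ x ⁻¹ ≈ 0#
      x⁻¹≉0 x⁻¹≈0 = 0≉1 (begin
        0#         ≈⟨ zeroʳ x ⟨
        x * 0#     ≈⟨ *-congˡ x⁻¹≈0 ⟨
        x * x ⁻¹   ≈⟨ ⁻¹-inverse x (pos⇒≉0 0<x) ⟩
        1#         ∎)
      x*[x⁻¹*x⁻¹]≈x⁻¹ : x * (x ⁻¹ * x ⁻¹) ≈ x ⁻¹
      x*[x⁻¹*x⁻¹]≈x⁻¹ = x*[y*x⁻¹]≈y (x ⁻¹) (pos⇒≉0 0<x)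

  0<x⇒0≤y⇒0<x+y : ∀ {x y} → 0# < x → 0# ≤ y → 0# < x + y
  0<x⇒0≤y⇒0<x+y {x} {y} 0<x (inj₁ 0<y) =
    <-trans 0<y (<-respˡ-≈ (+-identityˡ y) (+-mono-< y 0<x))
  0<x⇒0≤y⇒0<x+y {x} {y} 0<x (inj₂ 0≈y) =
    <-respʳ-≈ (trans (sym (+-identityʳ x)) (+-congˡ 0≈y)) 0<x

  0≤x⇒0<y⇒0<x+y : ∀ {x y} → 0# ≤ x → 0# < y → 0# < x + y
  0≤x⇒0<y⇒0<x+y {x} {y} 0≤x 0<y = <-respʳ-≈ (+-comm y x) (0<x⇒0≤y⇒0<x+y 0<y 0≤x)

  0≤x⇒0≤y⇒0≤x+y : ∀ {x y} → 0# ≤ x → 0# ≤ y → 0# ≤ x + y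
  0≤x⇒0≤y⇒0≤x+y (inj₁ 0<x) 0≤y = inj₁ (0<x⇒0≤y⇒0<x+y 0<x 0≤y)
  0≤x⇒0≤y⇒0≤x+y (inj₂ 0≈x) (inj₁ 0<y) = inj₁ (0≤x⇒0<y⇒0<x+y (inj₂ 0≈x) 0<y)
  0≤x⇒0≤y⇒0≤x+y (inj₂ 0≈x) (inj₂ 0≈y) =
    inj₂ (trans (sym (+-identityˡ 0#)) (+-cong 0≈x 0≈y))

  0≤x⇒0≤y⇒x+y≈0⇒x≈0 : ∀ {x y} → 0# ≤ x → 0# ≤ y → x + y ≈ 0# → x ≈ 0#
  0≤x⇒0≤y⇒x+y≈0⇒x≈0 (inj₁ 0<x) 0≤y x+y≈0 =
    ⊥-elim (irrefl (sym x+y≈0) (0<x⇒0≤y⇒0<x+y 0<x 0≤y))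
  0≤x⇒0≤y⇒x+y≈0⇒x≈0 (inj₂ 0≈x) 0≤y x+y≈0 = sym 0≈x

  0<x⇒0≤y⇒0≤x*y : ∀ {x y} → 0# < x → 0# ≤ y → 0# ≤ x * y
  0<x⇒0≤y⇒0≤x*y 0<x (inj₁ 0<y) = inj₁ (*-pos 0<x 0<y)
  0<x⇒0≤y⇒0≤x*y {x} 0<x (inj₂ 0≈y) = inj₂ (trans (sym (zeroʳ x)) (*-congˡ 0≈y))

  0≤x⇒0<y⇒0≤x*y : ∀ {x y} → 0# ≤ x → 0# < y → 0# ≤ x * y
  0≤x⇒0<y⇒0≤x*y {x} {y} 0≤x 0<y with 0<x⇒0≤y⇒0≤x*y 0<y 0≤x
  ... | inj₁ 0<yx = inj₁ (<-respʳ-≈ (*-comm y x) 0<yx)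
  ... | inj₂ 0≈yx = inj₂ (trans 0≈yx (*-comm y x))

module SumProperties {a ℓ} (F : OrderedField a ℓ) where
  open OrderedField F
  open Matrices F
  open OrderedFieldProperties F
  open SetoidReasoning setoid

  Σ-cong : ∀ {n} {f g : Vector n} → (∀ i → f i ≈ g i) → Σ f ≈ Σ g
  Σ-cong {zeroℕ}  f≈g = refl
  Σ-cong {sucℕ n} f≈g = +-cong (f≈g fz) (Σ-cong (λ i → f≈g (fs i)))

  Σ-0# : ∀ n → Σ {n} (λ _ → 0#) ≈ 0#
  Σ-0# zeroℕ    = refl
  Σ-0# (sucℕ n) = trans (+-identityˡ _) (Σ-0# n)

  Σ-distrib-+ : ∀ {n} (f g : Vector n) → Σ (λ i → f i + g i) ≈ Σ f + Σ g
  Σ-distrib-+ {zeroℕ}  f g = sym (+-identityˡ 0#)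
  Σ-distrib-+ {sucℕ n} f g = begin
    (f fz + g fz) + Σ (λ i → f′ i + g′ i)          ≈⟨ +-congˡ (Σ-distrib-+ f′ g′) ⟩
    (f fz + g fz) + (Σ f′ + Σ g′)                  ≈⟨ +-assoc (f fz) (g fz) _ ⟩
    f fz + (g fz + (Σ f′ + Σ g′))                  ≈⟨ +-congˡ (+-assoc (g fz) (Σ f′) (Σ g′)) ⟨
    f fz + ((g fz + Σ f′) + Σ g′)                  ≈⟨ +-congˡ (+-congʳ (+-comm (g fz) (Σ f′))) ⟩
    f fz + ((Σ f′ + g fz) + Σ g′)                  ≈⟨ +-congˡ (+-assoc (Σ f′) (g fz) (Σ g′)) ⟩
    f fz + (Σ f′ + (g fz + Σ g′))                  ≈⟨ +-assoc (f fz) (Σ f′) _ ⟨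
    (f fz + Σ f′) + (g fz + Σ g′)                  ∎
    where
      f′ g′ : Vector n
      f′ i = f (fs i)
      g′ i = g (fs i)

  *-distribˡ-Σ : ∀ {n} x (f : Vector n) → x * Σ f ≈ Σ (λ i → x * f i)
  *-distribˡ-Σ {zeroℕ}  x f = zeroʳ x
  *-distribˡ-Σ {sucℕ n} x f = trans (distribˡ x (f fz) _) (+-congˡ (*-distribˡ-Σ x (λ i → f (fs i))))

  *-distribʳ-Σ : ∀ {n} x (f : Vector n) → Σ f * x ≈ Σ (λ i → f i * x)
  *-distribʳ-Σ x f =
    trans (*-comm _ x) (trans (*-distribˡ-Σ x f) (Σ-cong (λ i → *-comm x (f i))))

  Σ-comm : ∀ {m n} (f : Matrix m n) → Σ (λ i → Σ (λ j → f i j)) ≈ Σ (λ j → Σ (λ i → f i j))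
  Σ-comm {zeroℕ}  {n} f = sym (Σ-0# n)
  Σ-comm {sucℕ m} f = trans (+-congˡ (Σ-comm (λ i → f (fs i))))
                            (sym (Σ-distrib-+ (f fz) (λ j → Σ (λ i → f (fs i) j))))

  Σ-nonneg : ∀ {n} (f : Vector n) → (∀ i → 0# ≤ f i) → 0# ≤ Σ f
  Σ-nonneg {zeroℕ}  f 0≤f = inj₂ refl
  Σ-nonneg {sucℕ n} f 0≤f = 0≤x⇒0≤y⇒0≤x+y (0≤f fz) (Σ-nonneg (λ i → f (fs i)) (λ i → 0≤f (fs i)))

  Σ-nonneg≈0⇒≈0 : ∀ {n} (f : Vector n) → (∀ i → 0# ≤ f i) → Σ f ≈ 0# → ∀ i → f i ≈ 0#
  Σ-nonneg≈0⇒≈0 {sucℕ n} f 0≤f Σf≈0 fz =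
    0≤x⇒0≤y⇒x+y≈0⇒x≈0 (0≤f fz) (Σ-nonneg _ (λ i → 0≤f (fs i))) Σf≈0
  Σ-nonneg≈0⇒≈0 {sucℕ n} f 0≤f Σf≈0 (fs i) =
    Σ-nonneg≈0⇒≈0 (λ i → f (fs i)) (λ i → 0≤f (fs i))
      (0≤x⇒0≤y⇒x+y≈0⇒x≈0 (Σ-nonneg _ (λ i → 0≤f (fs i))) (0≤f fz)
        (trans (+-comm _ (f fz)) Σf≈0)) i

  0<Σ⇒0<Σ-*-pos : ∀ {n} (f w : Vector n) → (∀ i → 0# ≤ f i) → PositiveVec w →
                   0# < Σ f → 0# < Σ (λ i → f i * w i)
  0<Σ⇒0<Σ-*-pos {zeroℕ}  f w 0≤f 0<w 0<Σf = ⊥-elim (irrefl refl 0<Σf)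
  0<Σ⇒0<Σ-*-pos {sucℕ n} f w 0≤f 0<w 0<Σf with 0≤f fz
  ... | inj₁ 0<f₀ = 0<x⇒0≤y⇒0<x+y (*-pos 0<f₀ (0<w fz))
      (Σ-nonneg _ (λ i → 0≤x⇒0<y⇒0≤x*y (0≤f (fs i)) (0<w (fs i))))
  ... | inj₂ 0≈f₀ = 0≤x⇒0<y⇒0<x+y (0≤x⇒0<y⇒0≤x*y (0≤f fz) (0<w fz))
      (0<Σ⇒0<Σ-*-pos (λ i → f (fs i)) (λ i → w (fs i)) (λ i → 0≤f (fs i)) (λ i → 0<w (fs i))
        (<-respʳ-≈ (trans (+-congʳ (sym 0≈f₀)) (+-identityˡ _)) 0<Σf))

module RescalingProperties {a ℓ} (F : OrderedField a ℓ) where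
  open OrderedField F
  open Matrices F
  open OrderedFieldProperties F
  open SumProperties F
  open GroupProperties +-group using (//-rightDividesˡ; identityˡ-unique)
  open SetoidReasoning setoid

  transpose : ∀ {m n} → Matrix m n → Matrix n m
  transpose A j i = A i j

  Σ[f*w]≈Σf⇒Σ[f*[w-1]]≈0 : ∀ {n} (f w : Vector n) →
    Σ (λ j → f j * w j) ≈ Σ f → Σ (λ j → f j * (w j - 1#)) ≈ 0#
  Σ[f*w]≈Σf⇒Σ[f*[w-1]]≈0 f w Σfw≈Σf = identityˡ-unique _ _ (begin
    Σ (λ j → f j * (w j - 1#)) + Σ f      ≈⟨ Σ-distrib-+ _ f ⟨
    Σ (λ j → f j * (w j - 1#) + f j)      ≈⟨ Σ-cong x*[y-1]+x≈x*y ⟩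
    Σ (λ j → f j * w j)                   ≈⟨ Σfw≈Σf ⟩
    Σ f                                   ∎)
    where
      x*[y-1]+x≈x*y : ∀ j → f j * (w j - 1#) + f j ≈ f j * w j
      x*[y-1]+x≈x*y j = begin
        f j * (w j - 1#) + f j          ≈⟨ +-congˡ (*-identityʳ (f j)) ⟨
        f j * (w j - 1#) + f j * 1#     ≈⟨ distribˡ (f j) _ 1# ⟨
        f j * (w j - 1# + 1#)           ≈⟨ *-congˡ (//-rightDividesˡ 1# (w j)) ⟩
        f j * w j                       ∎

  Σ[colsum*w]≈ΣΣ : ∀ {m n} (M : Matrix m n) (w : Vector n) →
    Σ (λ j → colsum M j * w j) ≈ Σ (λ i → Σ (λ j → M i j * w j))
  Σ[colsum*w]≈ΣΣ M w = trans (Σ-cong (λ j → *-distribʳ-Σ (w j) (λ i → M i j)))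
                             (sym (Σ-comm (λ i j → M i j * w j)))

  weights≈1 : ∀ {n} (d y c : Vector n) → PositiveVec d → (∀ j → d j * y j ≈ c j) →
    Σ (λ j → d j * (y j - 1#)) ≈ 0# → Σ (λ j → c j * (y j - 1#)) ≈ 0# → ∀ j → y j ≈ 1#
  weights≈1 {n} d y c 0<d dy≈c Σde≈0 Σce≈0 j = begin
    y j               ≈⟨ //-rightDividesˡ 1# (y j) ⟨
    e j + 1#          ≈⟨ +-congʳ (x*x≈0⇒x≈0 (x≉0⇒x*y≈0⇒y≈0 (pos⇒≉0 (0<d j)) (de²≈0 j))) ⟩
    0# + 1#           ≈⟨ +-identityˡ 1# ⟩
    1#                ∎
    where
      e : Vector n
      e j = y j - 1#
      de²+de≈ce : ∀ j → d j * (e j * e j) + d j * e j ≈ c j * e j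
      de²+de≈ce j = begin
        d j * (e j * e j) + d j * e j           ≈⟨ distribˡ (d j) _ _ ⟨
        d j * (e j * e j + e j)                 ≈⟨ *-congˡ (+-congˡ (*-identityʳ (e j))) ⟨
        d j * (e j * e j + e j * 1#)            ≈⟨ *-congˡ (distribˡ (e j) (e j) 1#) ⟨
        d j * (e j * (e j + 1#))                ≈⟨ *-congˡ (*-congˡ (//-rightDividesˡ 1# (y j))) ⟩
        d j * (e j * y j)                       ≈⟨ *-congˡ (*-comm (e j) (y j)) ⟩
        d j * (y j * e j)                       ≈⟨ *-assoc (d j) (y j) (e j) ⟨
        (d j * y j) * e j                       ≈⟨ *-congʳ (dy≈c j) ⟩
        c j * e j                               ∎
      Σde²≈0 : Σ (λ j → d j * (e j * e j)) ≈ 0#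
      Σde²≈0 = begin
        Σ (λ j → d j * (e j * e j))                         ≈⟨ +-identityʳ _ ⟨
        Σ (λ j → d j * (e j * e j)) + 0#                    ≈⟨ +-congˡ Σde≈0 ⟨
        Σ (λ j → d j * (e j * e j)) + Σ (λ j → d j * e j)   ≈⟨ Σ-distrib-+ (λ j → d j * (e j * e j)) _ ⟨
        Σ (λ j → d j * (e j * e j) + d j * e j)             ≈⟨ Σ-cong de²+de≈ce ⟩
        Σ (λ j → c j * e j)                                 ≈⟨ Σce≈0 ⟩
        0#                                                  ∎
      de²≈0 : ∀ j → d j * (e j * e j) ≈ 0#
      de²≈0 = Σ-nonneg≈0⇒≈0 _ (λ j → 0<x⇒0≤y⇒0≤x*y (0<d j) (0≤x*x (e j))) Σde²≈0

  colStochastic-of-rowsum-preserving-rescaling :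
    ∀ {m n} (B P : Matrix m n) (x : Vector m) (y c : Vector n) →
    ColStochastic c B → (∀ i → ¬ x i ≈ 0#) → (∀ i j → P i j ≈ x i * B i j) →
    (∀ j → 0# < colsum P j) → (∀ j → colsum P j * y j ≈ c j) →
    (∀ i → Σ (λ j → P i j * y j) ≈ rowsum P i) → ColStochastic c P
  colStochastic-of-rowsum-preserving-rescaling {m} {n} B P x y c
    B-col x≉0 P≈xB 0<colsumP colsumP*y≈c Py-rows j =
    begin
      colsum P j          ≈⟨ *-identityʳ _ ⟨
      colsum P j * 1#     ≈⟨ *-congˡ (y≈1 j) ⟨
      colsum P j * y j    ≈⟨ colsumP*y≈c j ⟩
      c j                 ∎
    where
      e : Vector n
      e j = y j - 1#
      Pe≈0 : ∀ i → Σ (λ j → P i j * e j) ≈ 0#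
      Pe≈0 i = Σ[f*w]≈Σf⇒Σ[f*[w-1]]≈0 (P i) y (Py-rows i)
      Be≈0 : ∀ i → Σ (λ j → B i j * e j) ≈ 0#
      Be≈0 i = x≉0⇒x*y≈0⇒y≈0 (x≉0 i) (begin
        x i * Σ (λ j → B i j * e j)     ≈⟨ *-distribˡ-Σ (x i) (λ j → B i j * e j) ⟩
        Σ (λ j → x i * (B i j * e j))   ≈⟨ Σ-cong (λ j → trans (sym (*-assoc _ _ _)) (*-congʳ (sym (P≈xB i j)))) ⟩
        Σ (λ j → P i j * e j)           ≈⟨ Pe≈0 i ⟩
        0#                              ∎)
      rows⇒cols : ∀ (M : Matrix m n) → (∀ i → Σ (λ j → M i j * e j) ≈ 0#) →
                  Σ (λ j → colsum M j * e j) ≈ 0#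
      rows⇒cols M Me≈0 = trans (Σ[colsum*w]≈ΣΣ M e) (trans (Σ-cong Me≈0) (Σ-0# m))
      y≈1 : ∀ j → y j ≈ 1#
      y≈1 = weights≈1 (colsum P) y c 0<colsumP colsumP*y≈c (rows⇒cols P Pe≈0)
              (trans (Σ-cong (λ j → *-congʳ (sym (B-col j)))) (rows⇒cols B Be≈0))

module Scaling {a ℓ} (F : OrderedField a ℓ) {m n : ℕ} (r : Matrices.Vector F m) (c : Matrices.Vector F n)
               (r-pos : Matrices.PositiveVec F r) (c-pos : Matrices.PositiveVec F c) where
  open OrderedField F
  open Matrices F
  open OrderedFieldProperties F
  open SumProperties F
  open RescalingProperties F

  Scalable : Matrix m n → Set ℓ
  Scalable A = Nonneg A × (∀ i → 0# < rowsum A i) × (∀ j → 0# < colsum A j)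

  rowFactor : Matrix m n → Vector m
  rowFactor A i = r i * rowsum A i ⁻¹

  colFactor : Matrix m n → Vector n
  colFactor A j = c j * colsum A j ⁻¹

  0<rowFactor : ∀ A → (∀ i → 0# < rowsum A i) → PositiveVec (rowFactor A)
  0<rowFactor A 0<rowsum i = *-pos (r-pos i) (0<x⇒0<x⁻¹ (0<rowsum i))

  0<colFactor : ∀ A → (∀ j → 0# < colsum A j) → PositiveVec (colFactor A)
  0<colFactor A 0<colsum j = *-pos (c-pos j) (0<x⇒0<x⁻¹ (0<colsum j))

  rowScale-rowStochastic : ∀ A → (∀ i → 0# < rowsum A i) → RowStochastic r (rowScale r A)
  rowScale-rowStochastic A 0<rowsum i =
    trans (sym (*-distribˡ-Σ (rowFactor A i) (A i)))
          (trans (*-comm _ _) (x*[y*x⁻¹]≈y (r i) (pos⇒≉0 (0<rowsum i))))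

  colScale-colStochastic : ∀ A → (∀ j → 0# < colsum A j) → ColStochastic c (colScale c A)
  colScale-colStochastic A 0<colsum j =
    trans (sym (*-distribʳ-Σ (colFactor A j) (λ i → A i j)))
          (x*[y*x⁻¹]≈y (c j) (pos⇒≉0 (0<colsum j)))

  rowScale-scalable : ∀ A → Scalable A → Scalable (rowScale r A)
  rowScale-scalable A (A-nonneg , 0<rowsum , 0<colsum) =
    (λ i j → 0<x⇒0≤y⇒0≤x*y (0<rowFactor A 0<rowsum i) (A-nonneg i j)) ,
    (λ i → <-respʳ-≈ (sym (rowScale-rowStochastic A 0<rowsum i)) (r-pos i)) ,
    (λ j → <-respʳ-≈ (Σ-cong (λ i → *-comm (A i j) _))
             (0<Σ⇒0<Σ-*-pos (λ i → A i j) (rowFactor A) (λ i → A-nonneg i j)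
                (0<rowFactor A 0<rowsum) (0<colsum j)))

  colScale-scalable : ∀ A → Scalable A → Scalable (colScale c A)
  colScale-scalable A (A-nonneg , 0<rowsum , 0<colsum) =
    (λ i j → 0≤x⇒0<y⇒0≤x*y (A-nonneg i j) (0<colFactor A 0<colsum j)) ,
    (λ i → 0<Σ⇒0<Σ-*-pos (A i) (colFactor A) (A-nonneg i) (0<colFactor A 0<colsum) (0<rowsum i)) ,
    (λ j → <-respʳ-≈ (sym (colScale-colStochastic A 0<colsum j)) (c-pos j))

  step-scalable : ∀ k A → Scalable A → Scalable (step r c k A)
  step-scalable zeroℕ               = colScale-scalable
  step-scalable (sucℕ zeroℕ)        = rowScale-scalable
  step-scalable (sucℕ (sucℕ k))     = step-scalable k

  altScale-scalable : ∀ A → Scalable A → ∀ k → Scalable (altScale r c A k)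
  altScale-scalable A A-sc zeroℕ    = A-sc
  altScale-scalable A A-sc (sucℕ k) = step-scalable k _ (altScale-scalable A A-sc k)

  rowScale-doublyStochastic : ∀ B → ColStochastic c B → Scalable B →
    DoublyStochastic r c (colScale c (rowScale r B)) → DoublyStochastic r c (rowScale r B)
  rowScale-doublyStochastic B B-col B-sc@(_ , 0<rowsumB , _) (Q-row , _) =
    rowScale-rowStochastic B 0<rowsumB ,
    colStochastic-of-rowsum-preserving-rescaling B P (rowFactor B) (colFactor P) c B-col
      (λ i → pos⇒≉0 (0<rowFactor B 0<rowsumB i)) (λ i j → refl) 0<colsumP
      (λ j → x*[y*x⁻¹]≈y (c j) (pos⇒≉0 (0<colsumP j)))
      (λ i → trans (Q-row i) (sym (rowScale-rowStochastic B 0<rowsumB i)))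
    where
      P = rowScale r B
      0<colsumP : ∀ j → 0# < colsum P j
      0<colsumP = proj₂ (proj₂ (rowScale-scalable B B-sc))

  colScale-doublyStochastic : ∀ B → RowStochastic r B → Scalable B →
    DoublyStochastic r c (rowScale r (colScale c B)) → DoublyStochastic r c (colScale c B)
  colScale-doublyStochastic B B-row B-sc@(_ , _ , 0<colsumB) (_ , Q-col) =
    colStochastic-of-rowsum-preserving-rescaling (transpose B) (transpose P) (colFactor B) (rowFactor P) r
      B-row (λ j → pos⇒≉0 (0<colFactor B 0<colsumB j)) (λ j i → *-comm (B i j) _) 0<rowsumP
      (λ i → x*[y*x⁻¹]≈y (r i) (pos⇒≉0 (0<rowsumP i)))
      (λ j → trans (Σ-cong (λ i → *-comm (P i j) _))
                   (trans (Q-col j) (sym (colScale-colStochastic B 0<colsumB j)))) ,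
    colScale-colStochastic B 0<colsumB
    where
      P = colScale c B
      0<rowsumP : ∀ i → 0# < rowsum P i
      0<rowsumP = proj₁ (proj₂ (colScale-scalable B B-sc))

  step-doublyStochastic-shift : ∀ k A → Scalable A →
    DoublyStochastic r c (step r c k (step r c (sucℕ k) (step r c k A))) →
    DoublyStochastic r c (step r c (sucℕ k) (step r c k A))
  step-doublyStochastic-shift zeroℕ A A-sc@(_ , _ , 0<colsum) =
    rowScale-doublyStochastic (colScale c A) (colScale-colStochastic A 0<colsum) (colScale-scalable A A-sc)
  step-doublyStochastic-shift (sucℕ zeroℕ) A A-sc@(_ , 0<rowsum , _) =
    colScale-doublyStochastic (rowScale r A) (rowScale-rowStochastic A 0<rowsum) (rowScale-scalable A A-sc)
  step-doublyStochastic-shift (sucℕ (sucℕ k)) = step-doublyStochastic-shift k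

  altScale-doublyStochastic-shift : ∀ A → Scalable A → ∀ k →
    DoublyStochastic r c (altScale r c A (sucℕ (sucℕ (sucℕ k)))) →
    DoublyStochastic r c (altScale r c A (sucℕ (sucℕ k)))
  altScale-doublyStochastic-shift A A-sc k =
    step-doublyStochastic-shift k (altScale r c A k) (altScale-scalable A A-sc k)

open import Data.Nat using (_<_; _≤_)

mainTheorem2 : ∀ {a ℓ : Level} (F : OrderedField a ℓ) →
    let open OrderedField F using (0#) renaming (_<_ to _<F_)
        open Matrices F
    in ∀ {m n : ℕ} (A : Matrix m n) (r : Vector m) (c : Vector n) →
       Nonneg A →
       (∀ i → 0# <F rowsum A i) →
       (∀ j → 0# <F colsum A j) →
       PositiveVec r →
       PositiveVec c →
       (L : ℕ) →
       DoublyStochastic r c (altScale r c A L) →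
       (∀ k → k < L → ¬ DoublyStochastic r c (altScale r c A k)) →
       L ≤ 2
mainTheorem2 F A r c A-nonneg 0<rowsum 0<colsum r-pos c-pos zeroℕ _ _ = z≤n
mainTheorem2 F A r c A-nonneg 0<rowsum 0<colsum r-pos c-pos 1 _ _ = s≤s z≤n
mainTheorem2 F A r c A-nonneg 0<rowsum 0<colsum r-pos c-pos 2 _ _ = s≤s (s≤s z≤n)
mainTheorem2 F A r c A-nonneg 0<rowsum 0<colsum r-pos c-pos (sucℕ (sucℕ (sucℕ k))) A₃₊ₖ-ds minimal =
  ⊥-elim (minimal (sucℕ (sucℕ k)) (n<1+n _)
    (altScale-doublyStochastic-shift A (A-nonneg , 0<rowsum , 0<colsum) k A₃₊ₖ-ds))
  where open Scaling F r c r-pos c-pos
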